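{- Let $G$ be a finite abstract simplicial complex and $x\in G$. Then for all $m\ge 1$, $$w_m(B(x))=w_m(U(x))-(-1)^m\,w_m(S(x)).$$
   Context: A finite abstract simplicial complex $G$ is a finite set of non-empty finite sets closed under taking non-empty subsets. For $y\in G$, $\omega(y)=(-1)^{|y|-1}$. The star of $x$ is $U(x)=\{y\in G: x\subset y\}$, the closed ball is $B(x)=\overline{U(x)}=\{z\in G: z\subset y\text{ for some }y\in U(x)\}$, and the unit sphere is $S(x)=B(x)\setminus U(x)$. For $A\subset G$ and $m\ge1$, $w_m(A)=\sum \prod_{j=1}^m\omega(x_j)$, the sum over all $m$-tuples $(x_1,\dots,x_m)\in A^m$ with $\bigcap_{j=1}^m x_j\in A$ (in particular non-empty). -}

module Defs where

open import Data.Bool using (Bool; true; false; T; _∧_; not; if_then_else_)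
open import Data.Nat using (ℕ; zero; suc; _∸_)
open import Data.Integer using (ℤ; +_; -_; _*_; _+_)
open import Data.Integer as ℤ using ()
open import Data.List using (List; []; _∷_; map; concatMap; foldr)
open import Data.Bool.ListAction using (any)
open import Data.Fin.Subset using (Subset; _⊆_; Nonempty; ⋂; ∣_∣; inside; outside)
open import Data.Fin.Subset.Properties using (_⊆?_)
open import Data.Vec using (_∷_; [])
open import Relation.Nullary.Decidable using (⌊_⌋)

-- Vertices are Fin n; a simplex (finite set of vertices) is a Subset n.
-- A family of simplices (a subset of G) is given by its characteristic function.
SetFamily : ℕ → Set
SetFamily n = Subset n → Bool

record Complex (n : ℕ) : Set where
  field
    mem       : SetFamily n
    nonempty  : ∀ x → T (mem x) → Nonempty x
    downClosed : ∀ x y → T (mem y) → Nonempty x → x ⊆ y → T (mem x)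
open Complex public

allSubsets : (n : ℕ) → List (Subset n)
allSubsets zero = [] ∷ []
allSubsets (suc n) = concatMap (λ p → (outside ∷ p) ∷ (inside ∷ p) ∷ []) (allSubsets n)

_⊆ᵇ_ : ∀ {n} → Subset n → Subset n → Bool
x ⊆ᵇ y = ⌊ x ⊆? y ⌋

U : ∀ {n} → Complex n → Subset n → SetFamily n
U G x y = mem G y ∧ (x ⊆ᵇ y)

B : ∀ {n} → Complex n → Subset n → SetFamily n
B {n} G x z = mem G z ∧ any (λ y → U G x y ∧ (z ⊆ᵇ y)) (allSubsets n)

S : ∀ {n} → Complex n → Subset n → SetFamily n
S G x z = B G x z ∧ not (U G x z)

ω : ∀ {n} → Subset n → ℤ
ω y = (- + 1) ℤ.^ (∣ y ∣ ∸ 1)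

tuples : (n m : ℕ) → List (List (Subset n))
tuples n zero = [] ∷ []
tuples n (suc m) = concatMap (λ x → map (x ∷_) (tuples n m)) (allSubsets n)

sumℤ : List ℤ → ℤ
sumℤ = foldr _+_ (+ 0)

prodω : ∀ {n} → List (Subset n) → ℤ
prodω = foldr (λ x r → ω x * r) (+ 1)

allIn : ∀ {n} → SetFamily n → List (Subset n) → Bool
allIn A = foldr (λ x r → A x ∧ r) true

w : ∀ {n} → ℕ → SetFamily n → ℤ
w {n} m A = sumℤ (map (λ xs → if allIn A xs ∧ A (⋂ xs) then prodω xs else + 0) (tuples n m))

-- Inclusion–exclusion over the common vertex set T of a tuple turns the
-- condition "the intersection is non-empty" into a sum over non-empty T: if A
-- contains every non-empty intersection of its members, then for m ≥ 1
-- w_m(A) = Σ_{T ≠ ∅} -(-1)^|T| h_A(T)^m, where h_A(T) is the ω-weight of the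
-- members of A containing T.  Since S = B \ U we have h_B = h_U + h_S.
-- If x ⊆ T no member of S contains T, so h_S(T) = 0.  Otherwise pick v ∈ x \ T:
-- adding or removing v is an ω-reversing involution on the members of B
-- containing T, so h_B(T) = 0 and h_S(T) = -h_U(T).  In both cases
-- h_B^m = h_U^m - (-1)^m h_S^m, and summing over T gives the theorem.
module Submission where

open import Defs
open import Data.Nat using (ℕ; _≤_; zero; suc)
open import Data.Bool using (Bool; true; false; T; _∧_; _∨_; not; if_then_else_)
open import Data.Bool.Properties using (T-∧; ∧-zeroʳ)
open import Data.Bool.ListAction using (any)
open import Data.Empty using (⊥-elim)
open import Data.Fin using (zero; suc)
open import Data.Fin.Subset using (Subset; _⊆_; _∈_; _∉_; Nonempty; ⋂; _∩_; ⊤; inside; outside; ∣_∣)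
open import Data.Fin.Subset.Properties using (_⊆?_; nonempty?; ⊆-refl; ⊆-trans; ⊆⊤; p∩q⊆p; p∩q⊆q; x∈p∩q⁺)
open import Data.Integer using (ℤ; +_; -_; _+_; _*_; _-_; _^_)
import Data.Integer.Properties as ℤ
open import Data.Integer.Tactic.RingSolver using (solve-∀)
open import Data.List using (List; []; _∷_; map; concatMap; _++_; foldr)
import Data.List.Membership.Propositional as List
import Data.List.Relation.Unary.Any as Any
open import Data.List.Relation.Unary.Any.Properties using (any⁺; any⁻; concatMap⁺)
open import Data.Product using (∃; _×_; _,_; proj₁; proj₂)
open import Data.Sum using (_⊎_; inj₁; inj₂)
open import Data.Vec using (_∷_; []; here; there; _[_]≔_)
open import Function using (Equivalence)
open import Algebra.Properties.AbelianGroup ℤ.+-0-abelianGroup using (inverseˡ-unique)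
open import Relation.Binary.PropositionalEquality
  using (_≡_; refl; sym; trans; cong; cong₂; subst; module ≡-Reasoning)
open import Relation.Nullary using (¬_; yes; no)
open import Relation.Nullary.Decidable using (toWitness; fromWitness; ⌊⌋-map′)

open ≡-Reasoning

private
  variable
    n : ℕ
    X Y : Set

T-injective : ∀ {a b} → (T a → T b) → (T b → T a) → a ≡ b
T-injective {false} {false} _ _ = refl
T-injective {false} {true}  _ b⇒a = ⊥-elim (b⇒a _)
T-injective {true}  {false} a⇒b _ = ⊥-elim (a⇒b _)
T-injective {true}  {true}  _ _ = refl

∧-congˡ-T : ∀ a {b c} → (T a → b ≡ c) → a ∧ b ≡ a ∧ c
∧-congˡ-T false _ = refl
∧-congˡ-T true  b≡c = b≡c _

T-not⁺ : ∀ {b} → ¬ T b → T (not b)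
T-not⁺ {false} _  = _
T-not⁺ {true}  ¬b = ¬b _

T-not⁻ : ∀ {b} → T (not b) → ¬ T b
T-not⁻ {false} _ ()

⟦_⟧ : Bool → ℤ
⟦ b ⟧ = if b then + 1 else + 0

if-then-0≡⟦⟧* : ∀ b (v : ℤ) → (if b then v else + 0) ≡ ⟦ b ⟧ * v
if-then-0≡⟦⟧* false v = sym (ℤ.*-zeroˡ v)
if-then-0≡⟦⟧* true  v = sym (ℤ.*-identityˡ v)

⟦∧⟧ : ∀ a b → ⟦ a ∧ b ⟧ ≡ ⟦ a ⟧ * ⟦ b ⟧
⟦∧⟧ false b = sym (ℤ.*-zeroˡ ⟦ b ⟧)
⟦∧⟧ true  b = sym (ℤ.*-identityˡ ⟦ b ⟧)

⟦⟧-¬T : ∀ {b} → ¬ T b → ⟦ b ⟧ ≡ + 0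
⟦⟧-¬T {false} _ = refl
⟦⟧-¬T {true}  ¬b = ⊥-elim (¬b _)

⟦⟧-split : ∀ u b → (T u → T b) → ⟦ b ⟧ ≡ ⟦ u ⟧ + ⟦ b ∧ not u ⟧
⟦⟧-split false false _ = refl
⟦⟧-split false true  _ = refl
⟦⟧-split true  false u⇒b = ⊥-elim (u⇒b _)
⟦⟧-split true  true  _ = refl

⟦⟧*-antisym : ∀ a b s (p q : ℤ) → (T s → a ≡ b) → (T s → p ≡ - q) →
              ⟦ a ∧ s ⟧ * p ≡ - (⟦ b ∧ s ⟧ * q)
⟦⟧*-antisym a b false p q _ _ rewrite ∧-zeroʳ a | ∧-zeroʳ b =
  trans (ℤ.*-zeroˡ p) (sym (cong -_ (ℤ.*-zeroˡ q)))
⟦⟧*-antisym a b true p q a≡b p≡-q rewrite a≡b _ | p≡-q _ =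
  sym (ℤ.neg-distribʳ-* ⟦ b ∧ true ⟧ q)

i+0*j≡i : ∀ (i j : ℤ) → i + + 0 * j ≡ i
i+0*j≡i = solve-∀

^-neg : ∀ (a : ℤ) k → (- a) ^ k ≡ (- + 1) ^ k * a ^ k
^-neg a zero    = refl
^-neg a (suc k) = trans (cong (- a *_) (^-neg a k)) (regroup a ((- + 1) ^ k) (a ^ k))
  where
  regroup : ∀ (a s p : ℤ) → - a * (s * p) ≡ - + 1 * s * (a * p)
  regroup = solve-∀

^-split : ∀ (b u s : ℤ) k → b ≡ u + s → s ≡ + 0 ⊎ b ≡ + 0 →
          b ^ suc k ≡ u ^ suc k - (- + 1) ^ suc k * s ^ suc k
^-split b u s k b≡u+s (inj₁ refl) = begin
  b ^ suc k
    ≡⟨ cong (_^ suc k) (trans b≡u+s (ℤ.+-identityʳ u)) ⟩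
  u ^ suc k
    ≡⟨ sym (ℤ.+-identityʳ (u ^ suc k)) ⟩
  u ^ suc k + - + 0
    ≡⟨ cong (λ e → u ^ suc k - e) (sym (ℤ.*-zeroʳ ((- + 1) ^ suc k))) ⟩
  u ^ suc k - (- + 1) ^ suc k * + 0
    ≡⟨ cong (λ e → u ^ suc k - (- + 1) ^ suc k * e) (sym (ℤ.*-zeroˡ ((+ 0) ^ k))) ⟩
  u ^ suc k - (- + 1) ^ suc k * (+ 0) ^ suc k ∎
^-split b u s k b≡u+s (inj₂ refl) = begin
  (+ 0) ^ suc k
    ≡⟨ ℤ.*-zeroˡ ((+ 0) ^ k) ⟩
  + 0
    ≡⟨ sym (ℤ.+-inverseʳ ((- s) ^ suc k)) ⟩
  (- s) ^ suc k - (- s) ^ suc k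
    ≡⟨ cong (λ e → (- s) ^ suc k - e) (^-neg s (suc k)) ⟩
  (- s) ^ suc k - (- + 1) ^ suc k * s ^ suc k
    ≡⟨ cong (λ e → e ^ suc k - (- + 1) ^ suc k * s ^ suc k) (sym u≡-s) ⟩
  u ^ suc k - (- + 1) ^ suc k * s ^ suc k ∎
  where
  u≡-s : u ≡ - s
  u≡-s = inverseˡ-unique u s (sym b≡u+s)

∑ : List X → (X → ℤ) → ℤ
∑ xs f = sumℤ (map f xs)

infix 5 ∑ ∏
syntax ∑ xs (λ a → e) = ∑[ a ← xs ] e

∏ : List X → (X → ℤ) → ℤ
∏ xs f = foldr (λ a r → f a * r) (+ 1) xs

syntax ∏ xs (λ a → e) = ∏[ a ← xs ] e

∑-cong : ∀ (xs : List X) {f g : X → ℤ} → (∀ a → f a ≡ g a) → ∑ xs f ≡ ∑ xs g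
∑-cong []       f≡g = refl
∑-cong (a ∷ xs) f≡g = cong₂ _+_ (f≡g a) (∑-cong xs f≡g)

∑-zero : ∀ (xs : List X) {f : X → ℤ} → (∀ a → f a ≡ + 0) → ∑ xs f ≡ + 0
∑-zero []       f≡0 = refl
∑-zero (a ∷ xs) f≡0 = cong₂ _+_ (f≡0 a) (∑-zero xs f≡0)

∑-++ : ∀ (xs ys : List X) (f : X → ℤ) → ∑ (xs ++ ys) f ≡ ∑ xs f + ∑ ys f
∑-++ []       ys f = sym (ℤ.+-identityˡ (∑ ys f))
∑-++ (x ∷ xs) ys f = trans (cong (_+_ (f x)) (∑-++ xs ys f)) (sym (ℤ.+-assoc (f x) _ _))

∑-concatMap : ∀ (g : X → List Y) (xs : List X) (f : Y → ℤ) →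
              ∑ (concatMap g xs) f ≡ ∑[ a ← xs ] ∑ (g a) f
∑-concatMap g []       f = refl
∑-concatMap g (a ∷ xs) f =
  trans (∑-++ (g a) (concatMap g xs) f) (cong (_+_ (∑ (g a) f)) (∑-concatMap g xs f))

∑-map : ∀ (g : X → Y) (xs : List X) (f : Y → ℤ) →
        ∑ (map g xs) f ≡ ∑[ a ← xs ] f (g a)
∑-map g []       f = refl
∑-map g (a ∷ xs) f = cong (_+_ (f (g a))) (∑-map g xs f)

∑-+ : ∀ (xs : List X) (f g : X → ℤ) → ∑[ a ← xs ] (f a + g a) ≡ ∑ xs f + ∑ xs g
∑-+ []       f g = refl
∑-+ (a ∷ xs) f g = trans (cong (_+_ (f a + g a)) (∑-+ xs f g)) (shuffle (f a) (g a) _ _)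
  where
  shuffle : ∀ (p q r s : ℤ) → p + q + (r + s) ≡ p + r + (q + s)
  shuffle = solve-∀

∑-*ˡ : ∀ (c : ℤ) (xs : List X) (f : X → ℤ) → ∑[ a ← xs ] (c * f a) ≡ c * ∑ xs f
∑-*ˡ c []       f = sym (ℤ.*-zeroʳ c)
∑-*ˡ c (a ∷ xs) f = trans (cong (_+_ (c * f a)) (∑-*ˡ c xs f)) (sym (ℤ.*-distribˡ-+ c (f a) _))

∑-*ʳ : ∀ (c : ℤ) (xs : List X) (f : X → ℤ) → ∑[ a ← xs ] (f a * c) ≡ ∑ xs f * c
∑-*ʳ c xs f = trans (∑-cong xs (λ a → ℤ.*-comm (f a) c))
                    (trans (∑-*ˡ c xs f) (ℤ.*-comm c (∑ xs f)))

∑-linear : ∀ (c : ℤ) (xs : List X) (f g : X → ℤ) →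
           ∑[ a ← xs ] (f a - c * g a) ≡ ∑ xs f - c * ∑ xs g
∑-linear c xs f g = begin
  ∑[ a ← xs ] (f a - c * g a)
    ≡⟨ ∑-+ xs f (λ a → - (c * g a)) ⟩
  ∑ xs f + (∑[ a ← xs ] - (c * g a))
    ≡⟨ cong (_+_ (∑ xs f)) (∑-cong xs (λ a → ℤ.neg-distribˡ-* c (g a))) ⟩
  ∑ xs f + (∑[ a ← xs ] - c * g a)
    ≡⟨ cong (_+_ (∑ xs f)) (∑-*ˡ (- c) xs g) ⟩
  ∑ xs f + - c * ∑ xs g
    ≡⟨ cong (_+_ (∑ xs f)) (sym (ℤ.neg-distribˡ-* c (∑ xs g))) ⟩
  ∑ xs f - c * ∑ xs g ∎

∑-swap : ∀ (xs : List X) (ys : List Y) (f : X → Y → ℤ) →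
         ∑[ a ← xs ] ∑[ b ← ys ] f a b ≡ ∑[ b ← ys ] ∑[ a ← xs ] f a b
∑-swap []       ys f = sym (∑-zero ys (λ _ → refl))
∑-swap (a ∷ xs) ys f =
  trans (cong (_+_ (∑ ys (f a))) (∑-swap xs ys f)) (sym (∑-+ ys (f a) (λ b → ∑[ a′ ← xs ] f a′ b)))

∏-⟦∧⟧ : ∀ (p q : SetFamily n) (f : Subset n → ℤ) (zs : List (Subset n)) →
        ∏[ z ← zs ] (⟦ p z ∧ q z ⟧ * f z) ≡ ⟦ allIn p zs ⟧ * ⟦ allIn q zs ⟧ * ∏ zs f
∏-⟦∧⟧ p q f []       = refl
∏-⟦∧⟧ p q f (z ∷ zs) = begin
  ⟦ p z ∧ q z ⟧ * f z * (∏[ z′ ← zs ] ⟦ p z′ ∧ q z′ ⟧ * f z′)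
    ≡⟨ cong₂ (λ a b → a * f z * b) (⟦∧⟧ (p z) (q z)) (∏-⟦∧⟧ p q f zs) ⟩
  ⟦ p z ⟧ * ⟦ q z ⟧ * f z * (⟦ allIn p zs ⟧ * ⟦ allIn q zs ⟧ * ∏ zs f)
    ≡⟨ regroup ⟦ p z ⟧ ⟦ q z ⟧ (f z) ⟦ allIn p zs ⟧ ⟦ allIn q zs ⟧ (∏ zs f) ⟩
  ⟦ p z ⟧ * ⟦ allIn p zs ⟧ * (⟦ q z ⟧ * ⟦ allIn q zs ⟧) * (f z * ∏ zs f)
    ≡⟨ sym (cong₂ (λ a b → a * b * (f z * ∏ zs f)) (⟦∧⟧ (p z) _) (⟦∧⟧ (q z) _)) ⟩
  ⟦ allIn p (z ∷ zs) ⟧ * ⟦ allIn q (z ∷ zs) ⟧ * ∏ (z ∷ zs) f ∎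
  where
  regroup : ∀ (a b c d e g : ℤ) → a * b * c * (d * e * g) ≡ a * d * (b * e) * (c * g)
  regroup = solve-∀

∑-allSubsets-suc : ∀ (f : Subset (suc n) → ℤ) →
  ∑[ z ← allSubsets (suc n) ] f z ≡ ∑[ p ← allSubsets n ] (f (outside ∷ p) + f (inside ∷ p))
∑-allSubsets-suc {n} f = trans (∑-concatMap _ (allSubsets n) f)
  (∑-cong (allSubsets n) (λ p → cong (_+_ (f (outside ∷ p))) (ℤ.+-identityʳ (f (inside ∷ p)))))

∑-tuples-suc : ∀ m (f : List (Subset n) → ℤ) →
  ∑[ t ← tuples n (suc m) ] f t ≡ ∑[ z ← allSubsets n ] ∑[ t ← tuples n m ] f (z ∷ t)
∑-tuples-suc {n} m f = trans (∑-concatMap _ (allSubsets n) f)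
  (∑-cong (allSubsets n) (λ z → ∑-map (z ∷_) (tuples n m) f))

∑-tuples-∏ : ∀ m (f : Subset n → ℤ) →
  ∑[ t ← tuples n m ] ∏ t f ≡ (∑[ z ← allSubsets n ] f z) ^ m
∑-tuples-∏     zero    f = refl
∑-tuples-∏ {n} (suc m) f = begin
  ∑[ t ← tuples n (suc m) ] ∏ t f
    ≡⟨ ∑-tuples-suc m (λ t → ∏ t f) ⟩
  ∑[ z ← allSubsets n ] ∑[ t ← tuples n m ] f z * ∏ t f
    ≡⟨ ∑-cong (allSubsets n) (λ z → ∑-*ˡ (f z) (tuples n m) (λ t → ∏ t f)) ⟩
  ∑[ z ← allSubsets n ] f z * (∑[ t ← tuples n m ] ∏ t f)
    ≡⟨ ∑-cong (allSubsets n) (λ z → cong (f z *_) (∑-tuples-∏ m f)) ⟩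
  ∑[ z ← allSubsets n ] f z * (∑ (allSubsets n) f) ^ m
    ≡⟨ ∑-*ʳ _ (allSubsets n) f ⟩
  (∑ (allSubsets n) f) ^ suc m ∎

∈-allSubsets : ∀ (z : Subset n) → z List.∈ allSubsets n
∈-allSubsets []            = Any.here refl
∈-allSubsets (outside ∷ p) =
  concatMap⁺ _ (Any.map (λ { refl → Any.here refl }) (∈-allSubsets p))
∈-allSubsets (inside  ∷ p) =
  concatMap⁺ _ (Any.map (λ { refl → Any.there (Any.here refl) }) (∈-allSubsets p))

T-any-allSubsets⁺ : ∀ (P : SetFamily n) z → T (P z) → T (any P (allSubsets n))
T-any-allSubsets⁺ P z Pz = any⁺ P (List.lose (∈-allSubsets z) Pz)

T-any-allSubsets⁻ : ∀ (P : SetFamily n) → T (any P (allSubsets n)) → ∃ λ z → T (P z)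
T-any-allSubsets⁻ {n} P h = Any.satisfied (any⁻ P (allSubsets n) h)

-- Unlike ⌊ nonempty? p ⌋, this computes on cons cells.
nonemptyᵇ : Subset n → Bool
nonemptyᵇ []      = false
nonemptyᵇ (b ∷ p) = b ∨ nonemptyᵇ p

T-nonemptyᵇ⁺ : ∀ {p : Subset n} → Nonempty p → T (nonemptyᵇ p)
T-nonemptyᵇ⁺ {p = inside  ∷ p} _                 = _
T-nonemptyᵇ⁺ {p = outside ∷ p} (suc i , there i∈p) = T-nonemptyᵇ⁺ (i , i∈p)

T-nonemptyᵇ⁻ : ∀ (p : Subset n) → T (nonemptyᵇ p) → Nonempty p
T-nonemptyᵇ⁻ (inside  ∷ p) _ = zero , here
T-nonemptyᵇ⁻ (outside ∷ p) h with T-nonemptyᵇ⁻ p h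
... | i , i∈p = suc i , there i∈p

nonempty-⊆ : ∀ {p q : Subset n} → p ⊆ q → Nonempty p → Nonempty q
nonempty-⊆ p⊆q (i , i∈p) = i , p⊆q i∈p

nonempty⇒∣∣≡suc : ∀ (p : Subset n) → Nonempty p → ∃ λ k → ∣ p ∣ ≡ suc k
nonempty⇒∣∣≡suc (inside  ∷ p) _ = ∣ p ∣ , refl
nonempty⇒∣∣≡suc (outside ∷ p) (suc i , there i∈p) = nonempty⇒∣∣≡suc p (i , i∈p)

T-⊆ᵇ⁺ : ∀ {p q : Subset n} → p ⊆ q → T (p ⊆ᵇ q)
T-⊆ᵇ⁺ = fromWitness

T-⊆ᵇ⁻ : ∀ {p q : Subset n} → T (p ⊆ᵇ q) → p ⊆ q
T-⊆ᵇ⁻ = toWitness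

-- Not definitional: ⌊_⌋ matches on the decision, which is stuck under Dec.map.
⊆ᵇ-outside∷ : ∀ b (p q : Subset n) → (outside ∷ p) ⊆ᵇ (b ∷ q) ≡ p ⊆ᵇ q
⊆ᵇ-outside∷ b p q = ⌊⌋-map′ _ _ (p ⊆? q)

⊆ᵇ-inside∷ : ∀ (p q : Subset n) → (inside ∷ p) ⊆ᵇ (inside ∷ q) ≡ p ⊆ᵇ q
⊆ᵇ-inside∷ p q = ⌊⌋-map′ _ _ (p ⊆? q)

⊆ᵇ-∩ : ∀ (t p q : Subset n) → t ⊆ᵇ (p ∩ q) ≡ t ⊆ᵇ p ∧ t ⊆ᵇ q
⊆ᵇ-∩ t p q = T-injective
  (λ t⊆p∩q → Equivalence.from T-∧
    (T-⊆ᵇ⁺ (⊆-trans (T-⊆ᵇ⁻ t⊆p∩q) (p∩q⊆p p q)) , T-⊆ᵇ⁺ (⊆-trans (T-⊆ᵇ⁻ t⊆p∩q) (p∩q⊆q p q))))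
  (λ t⊆p×t⊆q → let t⊆p , t⊆q = Equivalence.to T-∧ t⊆p×t⊆q in
    T-⊆ᵇ⁺ (λ i∈t → x∈p∩q⁺ (T-⊆ᵇ⁻ t⊆p i∈t , T-⊆ᵇ⁻ t⊆q i∈t)))

⊆ᵇ-⋂ : ∀ (t : Subset n) zs → t ⊆ᵇ ⋂ zs ≡ allIn (t ⊆ᵇ_) zs
⊆ᵇ-⋂ t []       = T-injective _ (λ _ → T-⊆ᵇ⁺ ⊆⊤)
⊆ᵇ-⋂ t (z ∷ zs) = trans (⊆ᵇ-∩ t z (⋂ zs)) (cong (t ⊆ᵇ z ∧_) (⊆ᵇ-⋂ t zs))

T-allIn-head : ∀ (A : SetFamily n) z zs → T (allIn A (z ∷ zs)) → T (A z)
T-allIn-head A z zs all∈A = proj₁ (Equivalence.to T-∧ all∈A)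

T-allIn-mono : ∀ {A A′ : SetFamily n} → (∀ {z} → T (A z) → T (A′ z)) →
               ∀ zs → T (allIn A zs) → T (allIn A′ zs)
T-allIn-mono A⇒A′ []       _      = _
T-allIn-mono A⇒A′ (z ∷ zs) all∈A with Equivalence.to T-∧ all∈A
... | z∈A , zs∈A = Equivalence.from T-∧ (A⇒A′ z∈A , T-allIn-mono A⇒A′ zs zs∈A)

⋂-⊆-head : ∀ (z : Subset n) zs → ⋂ (z ∷ zs) ⊆ z
⋂-⊆-head z zs = p∩q⊆p z (⋂ zs)

⊈-witness : ∀ (x t : Subset n) → ¬ x ⊆ t → ∃ λ v → v ∈ x × v ∉ t
⊈-witness []            []            x⊈t = ⊥-elim (x⊈t λ ())
⊈-witness (inside  ∷ x) (outside ∷ t) _   = zero , here , λ ()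
⊈-witness (inside  ∷ x) (inside  ∷ t) x⊈t
  with ⊈-witness x t (λ x⊆t → x⊈t λ { here → here ; (there i) → there (x⊆t i) })
... | v , v∈x , v∉t = suc v , there v∈x , λ { (there v∈t) → v∉t v∈t }
⊈-witness (outside ∷ x) (_       ∷ t) x⊈t
  with ⊈-witness x t (λ x⊆t → x⊈t λ { (there i) → there (x⊆t i) })
... | v , v∈x , v∉t = suc v , there v∈x , λ { (there v∈t) → v∉t v∈t }

∈-[]≔inside⁻ : ∀ v (z : Subset n) {i} → i ∈ z [ v ]≔ inside → i ≡ v ⊎ i ∈ z [ v ]≔ outside
∈-[]≔inside⁻ zero    (_ ∷ z) here        = inj₁ refl
∈-[]≔inside⁻ zero    (_ ∷ z) (there i∈z) = inj₂ (there i∈z)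
∈-[]≔inside⁻ (suc v) (_ ∷ z) here        = inj₂ here
∈-[]≔inside⁻ (suc v) (_ ∷ z) (there i∈z) with ∈-[]≔inside⁻ v z i∈z
... | inj₁ refl = inj₁ refl
... | inj₂ i∈z′ = inj₂ (there i∈z′)

[]≔inside⊆ : ∀ v (z y : Subset n) → z [ v ]≔ outside ⊆ y → v ∈ y → z [ v ]≔ inside ⊆ y
[]≔inside⊆ v z y z₀⊆y v∈y i∈z₁ with ∈-[]≔inside⁻ v z i∈z₁
... | inj₁ refl = v∈y
... | inj₂ i∈z₀ = z₀⊆y i∈z₀

⊆-[]≔outside : ∀ v (z t : Subset n) → v ∉ t → t ⊆ z [ v ]≔ inside → t ⊆ z [ v ]≔ outside
⊆-[]≔outside v z t v∉t t⊆z₁ i∈t with ∈-[]≔inside⁻ v z (t⊆z₁ i∈t)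
... | inj₁ refl = ⊥-elim (v∉t i∈t)
... | inj₂ i∈z₀ = i∈z₀

[]≔outside⊆[]≔inside : ∀ v (z : Subset n) → z [ v ]≔ outside ⊆ z [ v ]≔ inside
[]≔outside⊆[]≔inside zero    (_ ∷ z) (there i∈z) = there i∈z
[]≔outside⊆[]≔inside (suc v) (_ ∷ z) here        = here
[]≔outside⊆[]≔inside (suc v) (_ ∷ z) (there i∈z) = there ([]≔outside⊆[]≔inside v z i∈z)

∣[]≔inside∣ : ∀ v (z : Subset n) → ∣ z [ v ]≔ inside ∣ ≡ suc ∣ z [ v ]≔ outside ∣
∣[]≔inside∣ zero    (_       ∷ z) = refl
∣[]≔inside∣ (suc v) (inside  ∷ z) = cong suc (∣[]≔inside∣ v z)
∣[]≔inside∣ (suc v) (outside ∷ z) = ∣[]≔inside∣ v z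

-- Non-emptiness is needed since ω uses truncated subtraction: ω ⊥ = + 1.
ω-[]≔inside : ∀ v (z : Subset n) → Nonempty (z [ v ]≔ outside) →
              ω (z [ v ]≔ inside) ≡ - ω (z [ v ]≔ outside)
ω-[]≔inside v z nonempty with nonempty⇒∣∣≡suc _ nonempty
... | k , ∣z∣≡1+k rewrite ∣[]≔inside∣ v z | ∣z∣≡1+k = ℤ.-1*i≡-i _

∑-flip-antisym : ∀ v (f : Subset n → ℤ) →
  (∀ z → f (z [ v ]≔ inside) ≡ - f (z [ v ]≔ outside)) → ∑[ z ← allSubsets n ] f z ≡ + 0
∑-flip-antisym {suc n} zero f f-antisym = trans (∑-allSubsets-suc f) (∑-zero (allSubsets n) cancel)
  where
  cancel : ∀ p → f (outside ∷ p) + f (inside ∷ p) ≡ + 0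
  cancel p = trans (cong (_+_ (f (outside ∷ p))) (f-antisym (outside ∷ p)))
                   (ℤ.+-inverseʳ (f (outside ∷ p)))
∑-flip-antisym {suc n} (suc v) f f-antisym =
  trans (∑-allSubsets-suc f) (trans (∑-+ (allSubsets n) _ _)
  (cong₂ _+_ (∑-flip-antisym v (λ p → f (outside ∷ p)) (λ z → f-antisym (outside ∷ z)))
             (∑-flip-antisym v (λ p → f (inside ∷ p)) (λ z → f-antisym (inside ∷ z)))))

-- Inclusion–exclusion

μ : Subset n → ℤ
μ t = ⟦ nonemptyᵇ t ⟧ * - (- + 1) ^ ∣ t ∣

∑-⊆ᵇ-∷ : ∀ b (J : Subset n) (g : Subset (suc n) → ℤ) →
  ∑[ t ← allSubsets (suc n) ] ⟦ t ⊆ᵇ (b ∷ J) ⟧ * g t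
    ≡ ∑[ p ← allSubsets n ] ⟦ p ⊆ᵇ J ⟧ * (g (outside ∷ p) + ⟦ b ⟧ * g (inside ∷ p))
∑-⊆ᵇ-∷ {n} outside J g = trans (∑-allSubsets-suc {n} _) (∑-cong (allSubsets n) split)
  where
  distrib : ∀ (a x y : ℤ) → a * x + + 0 * y ≡ a * (x + + 0 * y)
  distrib = solve-∀
  split : ∀ p → ⟦ (outside ∷ p) ⊆ᵇ (outside ∷ J) ⟧ * g (outside ∷ p) + + 0 * g (inside ∷ p)
              ≡ ⟦ p ⊆ᵇ J ⟧ * (g (outside ∷ p) + + 0 * g (inside ∷ p))
  split p rewrite ⊆ᵇ-outside∷ outside p J = distrib ⟦ p ⊆ᵇ J ⟧ (g (outside ∷ p)) (g (inside ∷ p))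
∑-⊆ᵇ-∷ {n} inside J g = trans (∑-allSubsets-suc {n} _) (∑-cong (allSubsets n) split)
  where
  distrib : ∀ (a x y : ℤ) → a * x + a * y ≡ a * (x + + 1 * y)
  distrib = solve-∀
  split : ∀ p → ⟦ (outside ∷ p) ⊆ᵇ (inside ∷ J) ⟧ * g (outside ∷ p)
                + ⟦ (inside ∷ p) ⊆ᵇ (inside ∷ J) ⟧ * g (inside ∷ p)
              ≡ ⟦ p ⊆ᵇ J ⟧ * (g (outside ∷ p) + + 1 * g (inside ∷ p))
  split p rewrite ⊆ᵇ-outside∷ inside p J | ⊆ᵇ-inside∷ p J =
    distrib ⟦ p ⊆ᵇ J ⟧ (g (outside ∷ p)) (g (inside ∷ p))

∑-⊆-alternating : ∀ (J : Subset n) →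
  ∑[ t ← allSubsets n ] ⟦ t ⊆ᵇ J ⟧ * (- + 1) ^ ∣ t ∣ ≡ ⟦ not (nonemptyᵇ J) ⟧
∑-⊆-alternating []                  = refl
∑-⊆-alternating {suc n} (outside ∷ J) =
  trans (∑-⊆ᵇ-∷ outside J _) (trans (∑-cong (allSubsets n) drop-0) (∑-⊆-alternating J))
  where
  drop-0 : ∀ p → ⟦ p ⊆ᵇ J ⟧ * ((- + 1) ^ ∣ p ∣ + + 0 * (- + 1) ^ ∣ inside ∷ p ∣)
               ≡ ⟦ p ⊆ᵇ J ⟧ * (- + 1) ^ ∣ p ∣
  drop-0 p = cong (⟦ p ⊆ᵇ J ⟧ *_) (i+0*j≡i ((- + 1) ^ ∣ p ∣) ((- + 1) ^ ∣ inside ∷ p ∣))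
∑-⊆-alternating {suc n} (inside ∷ J) =
  trans (∑-⊆ᵇ-∷ inside J _) (∑-zero (allSubsets n) (λ p → cancel ⟦ p ⊆ᵇ J ⟧ ((- + 1) ^ ∣ p ∣)))
  where
  cancel : ∀ (a x : ℤ) → a * (x + + 1 * (- + 1 * x)) ≡ + 0
  cancel = solve-∀

∑-⊆-μ : ∀ (J : Subset n) → ∑[ t ← allSubsets n ] ⟦ t ⊆ᵇ J ⟧ * μ t ≡ ⟦ nonemptyᵇ J ⟧
∑-⊆-μ []                  = refl
∑-⊆-μ {suc n} (outside ∷ J) =
  trans (∑-⊆ᵇ-∷ outside J μ) (trans (∑-cong (allSubsets n) drop-0) (∑-⊆-μ J))
  where
  drop-0 : ∀ p → ⟦ p ⊆ᵇ J ⟧ * (μ p + + 0 * μ (inside ∷ p)) ≡ ⟦ p ⊆ᵇ J ⟧ * μ p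
  drop-0 p = cong (⟦ p ⊆ᵇ J ⟧ *_) (i+0*j≡i (μ p) (μ (inside ∷ p)))
∑-⊆-μ {suc n} (inside ∷ J) = begin
  ∑[ t ← allSubsets (suc n) ] ⟦ t ⊆ᵇ (inside ∷ J) ⟧ * μ t
    ≡⟨ ∑-⊆ᵇ-∷ inside J μ ⟩
  ∑[ p ← allSubsets n ] ⟦ p ⊆ᵇ J ⟧ * (μ p + + 1 * μ (inside ∷ p))
    ≡⟨ ∑-cong (allSubsets n) (λ p → split ⟦ p ⊆ᵇ J ⟧ (μ p) ((- + 1) ^ ∣ p ∣)) ⟩
  ∑[ p ← allSubsets n ] (⟦ p ⊆ᵇ J ⟧ * μ p + ⟦ p ⊆ᵇ J ⟧ * (- + 1) ^ ∣ p ∣)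
    ≡⟨ ∑-+ (allSubsets n) _ _ ⟩
  (∑[ p ← allSubsets n ] ⟦ p ⊆ᵇ J ⟧ * μ p) + (∑[ p ← allSubsets n ] ⟦ p ⊆ᵇ J ⟧ * (- + 1) ^ ∣ p ∣)
    ≡⟨ cong₂ _+_ (∑-⊆-μ J) (∑-⊆-alternating J) ⟩
  ⟦ nonemptyᵇ J ⟧ + ⟦ not (nonemptyᵇ J) ⟧
    ≡⟨ ⟦⟧+⟦not⟧ (nonemptyᵇ J) ⟩
  + 1 ∎
  where
  split : ∀ (a m x : ℤ) → a * (m + + 1 * (+ 1 * - (- + 1 * x))) ≡ a * m + a * x
  split = solve-∀
  ⟦⟧+⟦not⟧ : ∀ b → ⟦ b ⟧ + ⟦ not b ⟧ ≡ + 1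
  ⟦⟧+⟦not⟧ false = refl
  ⟦⟧+⟦not⟧ true  = refl

μ*-cong : ∀ (t : Subset n) {a b : ℤ} → (Nonempty t → a ≡ b) → μ t * a ≡ μ t * b
μ*-cong t {a} {b} a≡b with nonempty? t
... | yes t≢∅ = cong (μ t *_) (a≡b t≢∅)
... | no  t≡∅ = trans (μt*≡0 a) (sym (μt*≡0 b))
  where
  μt≡0 : μ t ≡ + 0
  μt≡0 = trans (cong (_* - (- + 1) ^ ∣ t ∣) (⟦⟧-¬T (λ h → t≡∅ (T-nonemptyᵇ⁻ t h))))
               (ℤ.*-zeroˡ (- (- + 1) ^ ∣ t ∣))
  μt*≡0 : ∀ c → μ t * c ≡ + 0
  μt*≡0 c = trans (cong (_* c) μt≡0) (ℤ.*-zeroˡ c)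

-- The weighted count of a family closed under non-empty meets

weightAbove : SetFamily n → Subset n → ℤ
weightAbove {n} A t = ∑[ z ← allSubsets n ] ⟦ A z ∧ t ⊆ᵇ z ⟧ * ω z

-- Only non-empty lists are constrained, as ⋂ [] = ⊤; hence w is expanded for m ≥ 1 only.
MeetClosed : SetFamily n → Set
MeetClosed {n} A = ∀ z (zs : List (Subset n)) →
  T (allIn A (z ∷ zs)) → A (⋂ (z ∷ zs)) ≡ nonemptyᵇ (⋂ (z ∷ zs))

meetClosed⁺ : ∀ {A : SetFamily n} → (∀ z → T (A z) → Nonempty z) →
  (∀ z zs → T (allIn A (z ∷ zs)) → Nonempty (⋂ (z ∷ zs)) → T (A (⋂ (z ∷ zs)))) → MeetClosed A
meetClosed⁺ members-nonempty nonempty-meet∈ z zs all∈A = T-injective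
  (λ meet∈A → T-nonemptyᵇ⁺ (members-nonempty _ meet∈A))
  (λ nonempty → nonempty-meet∈ z zs all∈A (T-nonemptyᵇ⁻ _ nonempty))

w≡∑μ*weightAbove^ : ∀ {A : SetFamily n} → MeetClosed A → ∀ m →
  w (suc m) A ≡ ∑[ t ← allSubsets n ] μ t * weightAbove A t ^ suc m
w≡∑μ*weightAbove^ {n} {A} meetClosed m = begin
  w (suc m) A
    ≡⟨ ∑-tuples-suc m counted ⟩
  ∑[ z ← subsets ] ∑[ zs ← tuples n m ] counted (z ∷ zs)
    ≡⟨ ∑-cong subsets (λ z → ∑-cong (tuples n m) (λ zs → meet-nonempty z zs)) ⟩
  ∑[ z ← subsets ] ∑[ zs ← tuples n m ] nonemptyMeet (z ∷ zs)
    ≡⟨ sym (∑-tuples-suc m nonemptyMeet) ⟩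
  ∑[ zs ← tuples n (suc m) ] nonemptyMeet zs
    ≡⟨ ∑-cong (tuples n (suc m)) inclusion–exclusion ⟩
  ∑[ zs ← tuples n (suc m) ] ∑[ t ← subsets ] μ t * above t zs
    ≡⟨ ∑-swap (tuples n (suc m)) subsets (λ zs t → μ t * above t zs) ⟩
  ∑[ t ← subsets ] ∑[ zs ← tuples n (suc m) ] μ t * above t zs
    ≡⟨ ∑-cong subsets (λ t → trans (∑-*ˡ (μ t) (tuples n (suc m)) (above t))
                (cong (μ t *_) (∑-tuples-∏ (suc m) (λ z → ⟦ A z ∧ t ⊆ᵇ z ⟧ * ω z)))) ⟩
  ∑[ t ← subsets ] μ t * weightAbove A t ^ suc m ∎
  where
  subsets = allSubsets n

  counted nonemptyMeet : List (Subset n) → ℤ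
  counted zs = if allIn A zs ∧ A (⋂ zs) then ∏ zs ω else + 0
  nonemptyMeet zs = ⟦ allIn A zs ∧ nonemptyᵇ (⋂ zs) ⟧ * ∏ zs ω

  above : Subset n → List (Subset n) → ℤ
  above t zs = ∏[ z ← zs ] ⟦ A z ∧ t ⊆ᵇ z ⟧ * ω z

  meet-nonempty : ∀ z zs → counted (z ∷ zs) ≡ nonemptyMeet (z ∷ zs)
  meet-nonempty z zs = trans (if-then-0≡⟦⟧* (allIn A (z ∷ zs) ∧ A (⋂ (z ∷ zs))) (∏ (z ∷ zs) ω))
    (cong (λ b → ⟦ b ⟧ * ∏ (z ∷ zs) ω) (∧-congˡ-T (allIn A (z ∷ zs)) (meetClosed z zs)))

  inclusion–exclusion : ∀ zs → nonemptyMeet zs ≡ ∑[ t ← subsets ] μ t * above t zs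
  inclusion–exclusion zs = begin
    ⟦ allIn A zs ∧ nonemptyᵇ (⋂ zs) ⟧ * ∏ zs ω
      ≡⟨ cong (_* ∏ zs ω) (⟦∧⟧ (allIn A zs) (nonemptyᵇ (⋂ zs))) ⟩
    a * ⟦ nonemptyᵇ (⋂ zs) ⟧ * ∏ zs ω
      ≡⟨ cong (λ e → a * e * ∏ zs ω) (sym (∑-⊆-μ (⋂ zs))) ⟩
    a * (∑[ t ← subsets ] ⟦ t ⊆ᵇ ⋂ zs ⟧ * μ t) * ∏ zs ω
      ≡⟨ cong (_* ∏ zs ω) (sym (∑-*ˡ a subsets (λ t → ⟦ t ⊆ᵇ ⋂ zs ⟧ * μ t))) ⟩
    (∑[ t ← subsets ] a * (⟦ t ⊆ᵇ ⋂ zs ⟧ * μ t)) * ∏ zs ω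
      ≡⟨ sym (∑-*ʳ (∏ zs ω) subsets (λ t → a * (⟦ t ⊆ᵇ ⋂ zs ⟧ * μ t))) ⟩
    ∑[ t ← subsets ] a * (⟦ t ⊆ᵇ ⋂ zs ⟧ * μ t) * ∏ zs ω
      ≡⟨ ∑-cong subsets factor ⟩
    ∑[ t ← subsets ] μ t * above t zs ∎
    where
    a = ⟦ allIn A zs ⟧
    regroup : ∀ (a c m p : ℤ) → a * (c * m) * p ≡ m * (a * c * p)
    regroup = solve-∀
    factor : ∀ t → a * (⟦ t ⊆ᵇ ⋂ zs ⟧ * μ t) * ∏ zs ω ≡ μ t * above t zs
    factor t rewrite ⊆ᵇ-⋂ t zs =
      trans (regroup a ⟦ allIn (t ⊆ᵇ_) zs ⟧ (μ t) (∏ zs ω))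
            (cong (μ t *_) (sym (∏-⟦∧⟧ A (t ⊆ᵇ_) ω zs)))

-- Star, ball and sphere of a simplex

module Ball (G : Complex n) (x : Subset n) where

  T-star⁻ : ∀ {z} → T (U G x z) → T (mem G z) × x ⊆ z
  T-star⁻ z∈U with Equivalence.to T-∧ z∈U
  ... | z∈G , x⊆z = z∈G , T-⊆ᵇ⁻ x⊆z

  T-star⁺ : ∀ {z} → T (mem G z) → x ⊆ z → T (U G x z)
  T-star⁺ z∈G x⊆z = Equivalence.from T-∧ (z∈G , T-⊆ᵇ⁺ x⊆z)

  T-ball⁻ : ∀ {z} → T (B G x z) → T (mem G z) × ∃ λ y → T (U G x y) × z ⊆ y
  T-ball⁻ z∈B with Equivalence.to T-∧ z∈B
  ... | z∈G , ∃y with T-any-allSubsets⁻ _ ∃y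
  ...   | y , y∈U×z⊆y with Equivalence.to T-∧ y∈U×z⊆y
  ...     | y∈U , z⊆y = z∈G , y , y∈U , T-⊆ᵇ⁻ z⊆y

  T-ball⁺ : ∀ {z y} → T (mem G z) → T (U G x y) → z ⊆ y → T (B G x z)
  T-ball⁺ {z} {y} z∈G y∈U z⊆y =
    Equivalence.from T-∧ (z∈G , T-any-allSubsets⁺ _ y (Equivalence.from T-∧ (y∈U , T-⊆ᵇ⁺ z⊆y)))

  star⊆ball : ∀ {z} → T (U G x z) → T (B G x z)
  star⊆ball z∈U = T-ball⁺ (proj₁ (T-star⁻ z∈U)) z∈U ⊆-refl

  ball-down : ∀ {y z} → T (B G x y) → Nonempty z → z ⊆ y → T (B G x z)
  ball-down y∈B nonempty z⊆y with T-ball⁻ y∈B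
  ... | y∈G , u , u∈U , y⊆u = T-ball⁺ (downClosed G _ _ y∈G nonempty z⊆y) u∈U (⊆-trans z⊆y y⊆u)

  T-sphere⁻ : ∀ {z} → T (S G x z) → T (B G x z) × ¬ T (U G x z)
  T-sphere⁻ z∈S with Equivalence.to T-∧ z∈S
  ... | z∈B , z∉U = z∈B , T-not⁻ z∉U

  T-sphere⁺ : ∀ {z} → T (B G x z) → ¬ T (U G x z) → T (S G x z)
  T-sphere⁺ z∈B z∉U = Equivalence.from T-∧ (z∈B , T-not⁺ z∉U)

  ball-meetClosed : MeetClosed (B G x)
  ball-meetClosed = meetClosed⁺ (λ z z∈B → nonempty G z (proj₁ (T-ball⁻ z∈B)))
    (λ z zs all∈B nonempty → ball-down (T-allIn-head (B G x) z zs all∈B) nonempty (⋂-⊆-head z zs))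

  star-meetClosed : MeetClosed (U G x)
  star-meetClosed = meetClosed⁺ (λ z z∈U → nonempty G z (proj₁ (T-star⁻ z∈U))) meet∈U
    where
    meet∈U : ∀ z zs → T (allIn (U G x) (z ∷ zs)) → Nonempty (⋂ (z ∷ zs)) → T (U G x (⋂ (z ∷ zs)))
    meet∈U z zs all∈U nonempty = T-star⁺
      (downClosed G _ z (proj₁ (T-star⁻ (T-allIn-head (U G x) z zs all∈U))) nonempty
                  (⋂-⊆-head z zs))
      (T-⊆ᵇ⁻ (subst T (sym (⊆ᵇ-⋂ x (z ∷ zs)))
                      (T-allIn-mono (λ z∈U → T-⊆ᵇ⁺ (proj₂ (T-star⁻ z∈U))) (z ∷ zs) all∈U)))

  sphere-meetClosed : MeetClosed (S G x)
  sphere-meetClosed =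
    meetClosed⁺ (λ z z∈S → nonempty G z (proj₁ (T-ball⁻ (proj₁ (T-sphere⁻ z∈S))))) meet∈S
    where
    meet∈S : ∀ z zs → T (allIn (S G x) (z ∷ zs)) → Nonempty (⋂ (z ∷ zs)) → T (S G x (⋂ (z ∷ zs)))
    meet∈S z zs all∈S nonempty with T-sphere⁻ (T-allIn-head (S G x) z zs all∈S)
    ... | z∈B , z∉U = T-sphere⁺ (ball-down z∈B nonempty (⋂-⊆-head z zs))
      (λ meet∈U → z∉U (T-star⁺ (proj₁ (T-ball⁻ z∈B))
                                (⊆-trans (proj₂ (T-star⁻ meet∈U)) (⋂-⊆-head z zs))))

  weightAbove-ball≡star+sphere : ∀ t →
    weightAbove (B G x) t ≡ weightAbove (U G x) t + weightAbove (S G x) t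
  weightAbove-ball≡star+sphere t = trans (∑-cong (allSubsets n) split) (∑-+ (allSubsets n) _ _)
    where
    distrib : ∀ (u s c w : ℤ) → (u + s) * c * w ≡ u * c * w + s * c * w
    distrib = solve-∀
    split : ∀ z → ⟦ B G x z ∧ t ⊆ᵇ z ⟧ * ω z
                ≡ ⟦ U G x z ∧ t ⊆ᵇ z ⟧ * ω z + ⟦ S G x z ∧ t ⊆ᵇ z ⟧ * ω z
    split z = begin
      ⟦ B G x z ∧ t ⊆ᵇ z ⟧ * ω z
        ≡⟨ cong (_* ω z) (⟦∧⟧ (B G x z) (t ⊆ᵇ z)) ⟩
      ⟦ B G x z ⟧ * ⟦ t ⊆ᵇ z ⟧ * ω z
        ≡⟨ cong (λ e → e * ⟦ t ⊆ᵇ z ⟧ * ω z) (⟦⟧-split (U G x z) (B G x z) star⊆ball) ⟩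
      (⟦ U G x z ⟧ + ⟦ S G x z ⟧) * ⟦ t ⊆ᵇ z ⟧ * ω z
        ≡⟨ distrib ⟦ U G x z ⟧ ⟦ S G x z ⟧ ⟦ t ⊆ᵇ z ⟧ (ω z) ⟩
      ⟦ U G x z ⟧ * ⟦ t ⊆ᵇ z ⟧ * ω z + ⟦ S G x z ⟧ * ⟦ t ⊆ᵇ z ⟧ * ω z
        ≡⟨ sym (cong₂ (λ a b → a * ω z + b * ω z) (⟦∧⟧ (U G x z) (t ⊆ᵇ z))
                                                   (⟦∧⟧ (S G x z) (t ⊆ᵇ z))) ⟩
      ⟦ U G x z ∧ t ⊆ᵇ z ⟧ * ω z + ⟦ S G x z ∧ t ⊆ᵇ z ⟧ * ω z ∎

  weightAbove-sphere-vanishes : ∀ {t} → x ⊆ t → weightAbove (S G x) t ≡ + 0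
  weightAbove-sphere-vanishes {t} x⊆t = ∑-zero (allSubsets n)
    (λ z → trans (cong (_* ω z) (⟦⟧-¬T (sphere-not-above z))) (ℤ.*-zeroˡ (ω z)))
    where
    sphere-not-above : ∀ z → ¬ T (S G x z ∧ t ⊆ᵇ z)
    sphere-not-above z z∈S×t⊆z with Equivalence.to T-∧ z∈S×t⊆z
    ... | z∈S , t⊆z with T-sphere⁻ z∈S
    ...   | z∈B , z∉U = z∉U (T-star⁺ (proj₁ (T-ball⁻ z∈B)) (⊆-trans x⊆t (T-⊆ᵇ⁻ t⊆z)))

  weightAbove-ball-vanishes : ∀ {t} → Nonempty t → ¬ x ⊆ t → weightAbove (B G x) t ≡ + 0
  weightAbove-ball-vanishes {t} t≢∅ x⊈t with ⊈-witness x t x⊈t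
  ... | v , v∈x , v∉t = ∑-flip-antisym v (λ z → ⟦ B G x z ∧ t ⊆ᵇ z ⟧ * ω z) flip
    where
    flip : ∀ z → ⟦ B G x (z [ v ]≔ inside) ∧ t ⊆ᵇ (z [ v ]≔ inside) ⟧ * ω (z [ v ]≔ inside)
               ≡ - (⟦ B G x (z [ v ]≔ outside) ∧ t ⊆ᵇ (z [ v ]≔ outside) ⟧ * ω (z [ v ]≔ outside))
    flip z = trans (cong (λ c → ⟦ B G x z₁ ∧ c ⟧ * ω z₁) above₁≡above₀)
                   (⟦⟧*-antisym (B G x z₁) (B G x z₀) (t ⊆ᵇ z₀) (ω z₁) (ω z₀) ball₁≡ball₀ ω₁≡-ω₀)
      where
      z₁ = z [ v ]≔ inside
      z₀ = z [ v ]≔ outside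

      above₁≡above₀ : t ⊆ᵇ z₁ ≡ t ⊆ᵇ z₀
      above₁≡above₀ = T-injective
        (λ t⊆z₁ → T-⊆ᵇ⁺ (⊆-[]≔outside v z t v∉t (T-⊆ᵇ⁻ t⊆z₁)))
        (λ t⊆z₀ → T-⊆ᵇ⁺ (⊆-trans (T-⊆ᵇ⁻ t⊆z₀) ([]≔outside⊆[]≔inside v z)))

      ball₁≡ball₀ : T (t ⊆ᵇ z₀) → B G x z₁ ≡ B G x z₀
      ball₁≡ball₀ t⊆z₀ = T-injective
        (λ z₁∈B → ball-down z₁∈B z₀≢∅ ([]≔outside⊆[]≔inside v z))
        (λ z₀∈B → let _ , y , y∈U , z₀⊆y = T-ball⁻ z₀∈B in
          ball-down (star⊆ball y∈U) (nonempty-⊆ ([]≔outside⊆[]≔inside v z) z₀≢∅)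
                    ([]≔inside⊆ v z y z₀⊆y (proj₂ (T-star⁻ y∈U) v∈x)))
        where
        z₀≢∅ = nonempty-⊆ (T-⊆ᵇ⁻ t⊆z₀) t≢∅

      ω₁≡-ω₀ : T (t ⊆ᵇ z₀) → ω z₁ ≡ - ω z₀
      ω₁≡-ω₀ t⊆z₀ = ω-[]≔inside v z (nonempty-⊆ (T-⊆ᵇ⁻ t⊆z₀) t≢∅)

  weightAbove-ball^ : ∀ {t} → Nonempty t → ∀ k →
    weightAbove (B G x) t ^ suc k
      ≡ weightAbove (U G x) t ^ suc k - (- + 1) ^ suc k * weightAbove (S G x) t ^ suc k
  weightAbove-ball^ {t} t≢∅ k =
    ^-split (weightAbove (B G x) t) (weightAbove (U G x) t) (weightAbove (S G x) t) k
            (weightAbove-ball≡star+sphere t) sphere-or-ball-vanishes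
    where
    sphere-or-ball-vanishes : weightAbove (S G x) t ≡ + 0 ⊎ weightAbove (B G x) t ≡ + 0
    sphere-or-ball-vanishes with x ⊆? t
    ... | yes x⊆t = inj₁ (weightAbove-sphere-vanishes x⊆t)
    ... | no  x⊈t = inj₂ (weightAbove-ball-vanishes t≢∅ x⊈t)

  μ*weightAbove-ball^ : ∀ t k → μ t * weightAbove (B G x) t ^ suc k
    ≡ μ t * weightAbove (U G x) t ^ suc k - (- + 1) ^ suc k * (μ t * weightAbove (S G x) t ^ suc k)
  μ*weightAbove-ball^ t k = trans (μ*-cong t (λ t≢∅ → weightAbove-ball^ t≢∅ k))
    (distrib (μ t) (weightAbove (U G x) t ^ suc k) ((- + 1) ^ suc k)
             (weightAbove (S G x) t ^ suc k))
    where
    distrib : ∀ (c u s v : ℤ) → c * (u - s * v) ≡ c * u - s * (c * v)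
    distrib = solve-∀

mainTheorem11 : (n : ℕ) (G : Complex n) (x : Subset n) → T (mem G x) →
    (m : ℕ) → 1 ≤ m →
    w m (B G x) ≡ w m (U G x) - ((- + 1) ^ m) * w m (S G x)
mainTheorem11 n G x _ zero    ()
mainTheorem11 n G x _ (suc m) _ = begin
  w (suc m) (B G x)
    ≡⟨ w≡∑μ*weightAbove^ ball-meetClosed m ⟩
  ∑[ t ← allSubsets n ] μ t * weightAbove (B G x) t ^ suc m
    ≡⟨ ∑-cong (allSubsets n) (λ t → μ*weightAbove-ball^ t m) ⟩
  ∑[ t ← allSubsets n ] (μ t * weightAbove (U G x) t ^ suc m
                         - sign * (μ t * weightAbove (S G x) t ^ suc m))
    ≡⟨ ∑-linear sign (allSubsets n) _ _ ⟩
  (∑[ t ← allSubsets n ] μ t * weightAbove (U G x) t ^ suc m)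
    - sign * (∑[ t ← allSubsets n ] μ t * weightAbove (S G x) t ^ suc m)
    ≡⟨ sym (cong₂ (λ a b → a - sign * b) (w≡∑μ*weightAbove^ star-meetClosed m)
                                          (w≡∑μ*weightAbove^ sphere-meetClosed m)) ⟩
  w (suc m) (U G x) - sign * w (suc m) (S G x) ∎
  where
  open Ball G x
  sign = (- + 1) ^ suc m
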